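{- Let $G$ be a connected graph with $n(G)\ge 2$. Then: (1) $\mathrm{vv}(G)=n(G)-1$ if and only if $G$ has a universal vertex; (2) $\mathrm{vv}(G)=n(G)-2$ if and only if $G$ has no universal vertex and $G$ contains a spanning double star (a spanning subgraph that is a double star).
   Context: All graphs are finite and simple; $n(G)$ is the order of $G$. A universal vertex is one adjacent to all other vertices. A double star is a tree in which exactly two vertices are not leaves. For $x\in V(G)$, a set $S\subseteq V(G)\setminus\{x\}$ is an $x$-visibility set if for every $y\in S$ there exists a shortest $x,y$-path $P$ with $V(P)\cap S=\{y\}$; $v_x(G)$ is the maximum size of an $x$-visibility set and $\mathrm{vv}(G)=\max_{x\in V(G)} v_x(G)$. -}

module Defs where

open import Data.Nat using (ℕ; zero; suc; _≤_; _+_)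
open import Data.Fin using (Fin)
open import Data.Fin.Subset using (Subset; _∈_; _∉_; ∣_∣)
open import Data.Bool using (Bool; true; false)
open import Data.Vec using (tabulate)
open import Data.List using (List; []; _∷_; filter)
open import Data.List.Relation.Unary.Unique.Propositional using (Unique)
import Data.List.Membership.Propositional as LM
open import Data.Product using (Σ; ∃; ∃-syntax; _×_)
open import Relation.Nullary using (¬_)
open import Relation.Binary.PropositionalEquality using (_≡_; _≢_)

record Graph (n : ℕ) : Set where
  field
    adj    : Fin n → Fin n → Bool
    sym    : ∀ u v → adj u v ≡ adj v u
    irrefl : ∀ v → adj v v ≡ false
open Graph public

module _ {n : ℕ} (G : Graph n) where

  Edge : Fin n → Fin n → Set
  Edge u v = adj G u v ≡ true

  data Walk : Fin n → Fin n → ℕ → Set where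
    nil  : ∀ x → Walk x x 0
    cons : ∀ {x y z k} → Edge x y → Walk y z k → Walk x z (suc k)

  verts : ∀ {x y k} → Walk x y k → List (Fin n)
  verts (nil x) = x ∷ []
  verts (cons {x = x} e w) = x ∷ verts w

  IsPath : ∀ {x y k} → Walk x y k → Set
  IsPath w = Unique (verts w)

  IsShortestPath : ∀ {x y k} → Walk x y k → Set
  IsShortestPath {x} {y} {k} w = IsPath w × (∀ {j} → Walk x y j → k ≤ j)

  Connected : Set
  Connected = ∀ u v → ∃[ k ] Walk u v k

  IsVisibilitySet : Fin n → Subset n → Set
  IsVisibilitySet x S =
    x ∉ S ×
    (∀ y → y ∈ S →
      ∃[ k ] Σ (Walk x y k) λ P →
        IsShortestPath P × (∀ v → v LM.∈ verts P → v ∈ S → v ≡ y))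

  IsVV : ℕ → Set
  IsVV k =
    (∃[ x ] ∃[ S ] (IsVisibilitySet x S × ∣ S ∣ ≡ k)) ×
    (∀ x S → IsVisibilitySet x S → ∣ S ∣ ≤ k)

  IsUniversal : Fin n → Set
  IsUniversal v = ∀ u → u ≢ v → Edge v u

  HasUniversalVertex : Set
  HasUniversalVertex = ∃[ v ] IsUniversal v

  -- a cycle: a closed walk of length ≥ 3 whose vertices (listed once
  -- around the cycle) are pairwise distinct
  HasCycle : Set
  HasCycle = ∃[ x ] ∃[ y ] ∃[ k ] Σ (Edge x y) λ e → Σ (Walk y x k) λ w →
    (2 ≤ k) × Unique (verts w)

  IsTree : Set
  IsTree = Connected × ¬ HasCycle

  degree : Fin n → ℕ
  degree v = ∣ tabulate (adj G v) ∣

  IsLeaf : Fin n → Set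
  IsLeaf v = degree v ≡ 1

  IsDoubleStar : Set
  IsDoubleStar = IsTree × (∃[ a ] ∃[ b ] (a ≢ b × ¬ IsLeaf a × ¬ IsLeaf b ×
                   (∀ v → v ≢ a → v ≢ b → IsLeaf v)))

SpanningSubgraph : ∀ {n} → Graph n → Graph n → Set
SpanningSubgraph {n} H G = ∀ (u v : Fin n) → Edge H u v → Edge G u v

HasSpanningDoubleStar : ∀ {n} → Graph n → Set
HasSpanningDoubleStar {n} G = ∃[ H ] (SpanningSubgraph H G × IsDoubleStar H)

-- An x-visibility set S omits x, and a shortest path witnessing that y ∈ S is visible has
-- no interior vertex in S.  If S omits only x, every such path is a single edge, so x is
-- universal; this settles vv = n ∸ 1.  If S omits only x and one more vertex z, every other
-- vertex is a neighbour of x or is reached through z, and hanging each vertex from x or from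
-- z (from a neighbour of z instead, when x ≁ z) gives a spanning double star.  Conversely,
-- the centres a, b of a spanning double star are adjacent and dominate the graph, so every
-- vertex other than a and b is visible from a directly or through b; without a universal
-- vertex no visibility set is larger than n ∸ 2.

module Submission where

open import Defs hiding (sym)
open import Data.Bool using (Bool; true; false; if_then_else_)
import Data.Bool.Properties as Bool
open import Data.Empty using (⊥; ⊥-elim)
open import Data.Fin using (Fin; zero; suc)
open import Data.Fin.Properties using (_≟_; ¬∀⟶∃¬)
import Data.Fin.Properties as Fin
open import Data.Fin.Subset using (Subset; inside; outside; _∈_; _∉_; _⊆_; ∁; ⁅_⁆; _-_; ∣_∣)
open import Data.Fin.Subset.Properties
open import Data.List using ([]; _∷_)
open import Data.List.Membership.Propositional as List using ()
open import Data.List.Relation.Unary.All as All using (All; []; _∷_)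
open import Data.List.Relation.Unary.AllPairs using ([]; _∷_)
open import Data.List.Relation.Unary.Any as Any using ()
open import Data.Nat using (ℕ; suc; pred; _≤_; _<_; _∸_; z≤n; s≤s)
open import Data.Nat.Properties
  using (≤-reflexive; ≤-antisym; <⇒≱; <-irrefl; ≤∧≢⇒<; 1+n≰n; suc[m]≤n⇒m≤pred[n]; pred[m∸n]≡m∸[1+n])
open import Data.Product using (Σ; ∃-syntax; _×_; _,_; proj₁; proj₂)
open import Data.Sum using (_⊎_; inj₁; inj₂; [_,_]′)
open import Data.Vec using (_∷_; tabulate; here; there)
open import Data.Vec.Properties using (lookup∘tabulate; lookup⇒[]=; []=⇒lookup)
open import Function.Base using (id; _∘_)
open import Function.Bundles using (_⇔_; mk⇔)
open import Relation.Nullary using (¬_; Dec; yes; no; does; proof; Reflects; invert)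
open import Relation.Nullary.Decidable
  using (¬?; _→-dec_; _×-dec_; _⊎-dec_; decidable-stable; dec-true; dec-false; does-⇔)
open import Relation.Unary using (Pred; Decidable)
open import Relation.Binary.PropositionalEquality
  using (_≡_; _≢_; refl; sym; trans; cong; subst; module ≡-Reasoning)

x≢y⇒x∈∁⁅y⁆ : ∀ {n} {x y : Fin n} → x ≢ y → x ∈ ∁ ⁅ y ⁆
x≢y⇒x∈∁⁅y⁆ = x∉p⇒x∈∁p ∘ x≢y⇒x∉⁅y⁆

x∈∁⁅y⁆⇒x≢y : ∀ {n} {x y : Fin n} → x ∈ ∁ ⁅ y ⁆ → x ≢ y
x∈∁⁅y⁆⇒x≢y = x∉⁅y⁆⇒x≢y ∘ x∈∁p⇒x∉p

x∈p-y⇒x≢y : ∀ {n} {x y : Fin n} {p : Subset n} → x ∈ p - y → x ≢ y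
x∈p-y⇒x≢y {x = zero}  {zero}  {_ ∷ _} ()
x∈p-y⇒x≢y {x = suc x} {suc y} {_ ∷ _} (there x∈p-y) = x∈p-y⇒x≢y x∈p-y ∘ Fin.suc-injective
x∈p-y⇒x≢y {x = zero}  {suc y} _ ()
x∈p-y⇒x≢y {x = suc x} {zero}  _ ()

x∉p⇒p⊆∁⁅x⁆ : ∀ {n} {x : Fin n} {p : Subset n} → x ∉ p → p ⊆ ∁ ⁅ x ⁆
x∉p⇒p⊆∁⁅x⁆ x∉p y∈p = x≢y⇒x∈∁⁅y⁆ (λ { refl → x∉p y∈p })

x∈p⇒suc∣p-x∣≡∣p∣ : ∀ {n} {x : Fin n} {p : Subset n} → x ∈ p → suc ∣ p - x ∣ ≡ ∣ p ∣
x∈p⇒suc∣p-x∣≡∣p∣ {p = inside  ∷ p} here          = cong (suc ∘ ∣_∣) (p─⊥≡p p)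
x∈p⇒suc∣p-x∣≡∣p∣ {p = inside  ∷ p} (there x∈p) = cong suc (x∈p⇒suc∣p-x∣≡∣p∣ x∈p)
x∈p⇒suc∣p-x∣≡∣p∣ {p = outside ∷ p} (there x∈p) = x∈p⇒suc∣p-x∣≡∣p∣ x∈p

∣∁⁅x⁆∣≡n∸1 : ∀ {n} (x : Fin n) → ∣ ∁ ⁅ x ⁆ ∣ ≡ n ∸ 1
∣∁⁅x⁆∣≡n∸1 {n} x = trans (∣∁p∣≡n∸∣p∣ ⁅ x ⁆) (cong (n ∸_) (∣⁅x⁆∣≡1 x))

∣∁⁅x⁆-y∣≡n∸2 : ∀ {n} {x y : Fin n} → y ≢ x → ∣ ∁ ⁅ x ⁆ - y ∣ ≡ n ∸ 2
∣∁⁅x⁆-y∣≡n∸2 {n} {x} {y} y≢x = begin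
  ∣ ∁ ⁅ x ⁆ - y ∣          ≡⟨ cong pred (x∈p⇒suc∣p-x∣≡∣p∣ (x≢y⇒x∈∁⁅y⁆ y≢x)) ⟩
  pred ∣ ∁ ⁅ x ⁆ ∣         ≡⟨ cong pred (∣∁⁅x⁆∣≡n∸1 x) ⟩
  pred (n ∸ 1)             ≡⟨ pred[m∸n]≡m∸[1+n] n 1 ⟩
  n ∸ 2                    ∎
  where open ≡-Reasoning

p⊆q∧∣q∣≤∣p∣⇒q⊆p : ∀ {n} {p q : Subset n} → p ⊆ q → ∣ q ∣ ≤ ∣ p ∣ → q ⊆ p
p⊆q∧∣q∣≤∣p∣⇒q⊆p {p = p} {q} p⊆q ∣q∣≤∣p∣ {x} x∈q = decidable-stable (x ∈? p)
  λ x∉p → <⇒≱ (p⊂q⇒∣p∣<∣q∣ (p⊆q , x , x∈q , x∉p)) ∣q∣≤∣p∣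

∃-outside : ∀ {n q} {Q : Pred (Fin n) q} → Decidable Q → ∀ x →
  ¬ (∀ y → y ≢ x → Q y) → ∃[ y ] (y ≢ x × ¬ Q y)
∃-outside {n} Q? x ¬∀ with ¬∀⟶∃¬ n _ (λ y → ¬? (y ≟ x) →-dec Q? y) ¬∀
... | y , ¬[y≢x→Qy] = y , (λ y≡x → ¬[y≢x→Qy] λ y≢x → ⊥-elim (y≢x y≡x)) , (λ Qy → ¬[y≢x→Qy] λ _ → Qy)

pair-pigeonhole : ∀ {a} {A : Set a} {p q x y z : A} →
  (x ≡ p ⊎ x ≡ q) → (y ≡ p ⊎ y ≡ q) → (z ≡ p ⊎ z ≡ q) → x ≢ y → y ≢ z → x ≢ z → ⊥
pair-pigeonhole (inj₁ refl) (inj₁ refl) _           x≢y _   _   = x≢y refl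
pair-pigeonhole (inj₂ refl) (inj₂ refl) _           x≢y _   _   = x≢y refl
pair-pigeonhole _           (inj₁ refl) (inj₁ refl) _   y≢z _   = y≢z refl
pair-pigeonhole _           (inj₂ refl) (inj₂ refl) _   y≢z _   = y≢z refl
pair-pigeonhole (inj₁ refl) (inj₂ refl) (inj₁ refl) _   _   x≢z = x≢z refl
pair-pigeonhole (inj₂ refl) (inj₁ refl) (inj₂ refl) _   _   x≢z = x≢z refl

module _ {n : ℕ} (G : Graph n) where

  Edge? : ∀ u v → Dec (Edge G u v)
  Edge? u v = adj G u v Bool.≟ true

  edge-sym : ∀ {u v} → Edge G u v → Edge G v u
  edge-sym {u} {v} e = trans (Graph.sym G v u) e

  edge⇒≢ : ∀ {u v} → Edge G u v → u ≢ v
  edge⇒≢ {u} e refl with trans (sym e) (irrefl G u)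
  ... | ()

  head∈verts : ∀ {u v k} (w : Walk G u v k) → u List.∈ verts G w
  head∈verts (nil _)    = Any.here refl
  head∈verts (cons _ _) = Any.here refl

  last∈verts : ∀ {u v k} (w : Walk G u v k) → v List.∈ verts G w
  last∈verts (nil _)    = Any.here refl
  last∈verts (cons _ w) = Any.there (last∈verts w)

  _++ᵂ_ : ∀ {u v w k j} → Walk G u v k → Walk G v w j → ∃[ i ] Walk G u w i
  nil _    ++ᵂ w = _ , w
  cons e v ++ᵂ w = _ , cons e (proj₂ (v ++ᵂ w))

  reverseᵂ : ∀ {u v k} → Walk G u v k → ∃[ j ] Walk G v u j
  reverseᵂ (nil u)        = 0 , nil u
  reverseᵂ {u} (cons e w) = proj₂ (reverseᵂ w) ++ᵂ cons (edge-sym e) (nil u)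

  reach-root⇒connected : ∀ r → (∀ v → ∃[ k ] Walk G v r k) → Connected G
  reach-root⇒connected r reach u v = proj₂ (reach u) ++ᵂ proj₂ (reverseᵂ (proj₂ (reach v)))

  walk-preserves : ∀ {ℓ} (P : Pred (Fin n) ℓ) → (∀ {s t} → P s → Edge G s t → P t) →
    ∀ {u v k} → Walk G u v k → P u → P v
  walk-preserves P step (nil _)    Pu = Pu
  walk-preserves P step (cons e w) Pu = walk-preserves P step w (step Pu e)

  ≢⇒1≤length : ∀ {u v k} → u ≢ v → Walk G u v k → 1 ≤ k
  ≢⇒1≤length u≢u (nil _)    = ⊥-elim (u≢u refl)
  ≢⇒1≤length _   (cons _ _) = s≤s z≤n

  nonadjacent⇒2≤length : ∀ {u v k} → u ≢ v → ¬ Edge G u v → Walk G u v k → 2 ≤ k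
  nonadjacent⇒2≤length u≢u _  (nil _)             = ⊥-elim (u≢u refl)
  nonadjacent⇒2≤length _   ¬e (cons e (nil _))    = ⊥-elim (¬e e)
  nonadjacent⇒2≤length _   _  (cons _ (cons _ _)) = s≤s (s≤s z≤n)

  Visible : Fin n → Subset n → Fin n → Set
  Visible x S y = ∃[ k ] Σ (Walk G x y k) λ P →
    IsShortestPath G P × (∀ v → v List.∈ verts G P → v ∈ S → v ≡ y)

  visible-neighbour : ∀ {x y S} → Edge G x y → x ∉ S → Visible x S y
  visible-neighbour {x} {y} {S} e x∉S =
    1 , cons e (nil y) , ((edge⇒≢ e ∷ []) ∷ [] ∷ [] , ≢⇒1≤length (edge⇒≢ e)) , only-y
    where
    only-y : ∀ v → v List.∈ x ∷ y ∷ [] → v ∈ S → v ≡ y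
    only-y v (Any.here refl)            v∈S = ⊥-elim (x∉S v∈S)
    only-y v (Any.there (Any.here v≡y)) _   = v≡y

  visible-through : ∀ {x y z S} → Edge G x z → Edge G z y → ¬ Edge G x y → x ≢ y →
    x ∉ S → z ∉ S → Visible x S y
  visible-through {x} {y} {z} {S} e e′ ¬e x≢y x∉S z∉S =
    2 , cons e (cons e′ (nil y)) ,
    ((edge⇒≢ e ∷ x≢y ∷ []) ∷ (edge⇒≢ e′ ∷ []) ∷ [] ∷ [] , nonadjacent⇒2≤length x≢y ¬e) , only-y
    where
    only-y : ∀ v → v List.∈ x ∷ z ∷ y ∷ [] → v ∈ S → v ≡ y
    only-y v (Any.here refl)                        v∈S = ⊥-elim (x∉S v∈S)
    only-y v (Any.there (Any.here refl))            v∈S = ⊥-elim (z∉S v∈S)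
    only-y v (Any.there (Any.there (Any.here v≡y))) _   = v≡y

  -- The interior of a path witnessing visibility avoids S, so here it is empty or just z.
  visible⇒adjacent⊎through : ∀ {x y z S} → x ∉ S → (∀ v → v ≢ x → v ≢ z → v ∈ S) →
    y ∈ S → Visible x S y → Edge G x y ⊎ (Edge G x z × Edge G z y)
  visible⇒adjacent⊎through x∉S _ y∈S (_ , nil _ , _) = ⊥-elim (x∉S y∈S)
  visible⇒adjacent⊎through {x} {y} {z} {S} x∉S covered y∈S
    (_ , cons {y = v} e w , ((x∉w ∷ _) , _) , only-y) with v ≟ y | v ≟ z
  ... | yes refl | _      = inj₁ e
  ... | no v≢y   | no v≢z =
    ⊥-elim (v≢y (only-y v (Any.there (head∈verts w)) (covered v (edge⇒≢ e ∘ sym) v≢z)))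
  ... | no v≢y   | yes refl = inj₂ (through w x∉w only-y)
    where
    through : ∀ {k} (w : Walk G z y k) → All (x ≢_) (verts G w) →
      (∀ u → u List.∈ x ∷ verts G w → u ∈ S → u ≡ y) → Edge G x z × Edge G z y
    through (nil _) _ _ = ⊥-elim (v≢y refl)
    through (cons {y = u} e′ w′) (_ ∷ x∉w′) only-y′ with u ≟ y
    ... | yes refl = e , e′
    ... | no u≢y   = ⊥-elim (u≢y (only-y′ u (Any.there (Any.there (head∈verts w′)))
      (covered u (All.lookup x∉w′ (head∈verts w′) ∘ sym) (edge⇒≢ e′ ∘ sym))))

  neighbourhood : Fin n → Subset n
  neighbourhood v = tabulate (adj G v)

  edge⇒∈neighbourhood : ∀ {v u} → Edge G v u → u ∈ neighbourhood v
  edge⇒∈neighbourhood {v} {u} e = lookup⇒[]= u _ (trans (lookup∘tabulate (adj G v) u) e)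

  ∈neighbourhood⇒edge : ∀ {v u} → u ∈ neighbourhood v → Edge G v u
  ∈neighbourhood⇒edge {v} {u} u∈N = trans (sym (lookup∘tabulate (adj G v) u)) ([]=⇒lookup u∈N)

  two-neighbours⇒¬leaf : ∀ {v u u′} → Edge G v u → Edge G v u′ → u ≢ u′ → ¬ IsLeaf G v
  two-neighbours⇒¬leaf {v} {u} {u′} e e′ u≢u′ leaf = <-irrefl (sym leaf)
    (subst (_< degree G v) (∣⁅x⁆∣≡1 u)
      (p⊂q⇒∣p∣<∣q∣ (⁅u⁆⊆N , u′ , edge⇒∈neighbourhood e′ , x≢y⇒x∉⁅y⁆ (u≢u′ ∘ sym))))
    where
    ⁅u⁆⊆N : ⁅ u ⁆ ⊆ neighbourhood v
    ⁅u⁆⊆N x∈⁅u⁆ = subst (_∈ neighbourhood v) (sym (x∈⁅y⁆⇒x≡y u x∈⁅u⁆)) (edge⇒∈neighbourhood e)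

  leaf-neighbour-unique : ∀ {v u u′} → IsLeaf G v → Edge G v u → Edge G v u′ → u ≡ u′
  leaf-neighbour-unique {u = u} {u′} leaf e e′ =
    decidable-stable (u ≟ u′) (λ u≢u′ → two-neighbours⇒¬leaf e e′ u≢u′ leaf)

  unique-neighbour⇒leaf : ∀ {v u} → Edge G v u → (∀ w → Edge G v w → w ≡ u) → IsLeaf G v
  unique-neighbour⇒leaf {v} {u} e unique = ≤-antisym
    (subst (degree G v ≤_) (∣⁅x⁆∣≡1 u) (p⊆q⇒∣p∣≤∣q∣ N⊆⁅u⁆))
    (subst (_≤ degree G v) (∣⁅x⁆∣≡1 u) (p⊆q⇒∣p∣≤∣q∣ ⁅u⁆⊆N))
    where
    N⊆⁅u⁆ : neighbourhood v ⊆ ⁅ u ⁆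
    N⊆⁅u⁆ {w} w∈N = subst (_∈ ⁅ u ⁆) (sym (unique w (∈neighbourhood⇒edge w∈N))) (x∈⁅x⁆ u)
    ⁅u⁆⊆N : ⁅ u ⁆ ⊆ neighbourhood v
    ⁅u⁆⊆N x∈⁅u⁆ = subst (_∈ neighbourhood v) (sym (x∈⁅y⁆⇒x≡y u x∈⁅u⁆)) (edge⇒∈neighbourhood e)

  leaf-neighbours⇒star : Connected G → ∀ {v} → (∀ s → Edge G v s → IsLeaf G s) →
    ∀ u → u ≡ v ⊎ Edge G v u
  leaf-neighbours⇒star connected {v} leaves u =
    walk-preserves InStar step (proj₂ (connected v u)) (inj₁ refl)
    where
    InStar : Fin n → Set
    InStar s = s ≡ v ⊎ Edge G v s
    step : ∀ {s t} → InStar s → Edge G s t → InStar t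
    step (inj₁ refl) e = inj₂ e
    step (inj₂ e)    e′ = inj₁ (leaf-neighbour-unique (leaves _ e) e′ (edge-sym e))

  module _ (connected : Connected G) {a b : Fin n}
           (leaves : ∀ v → v ≢ a → v ≢ b → IsLeaf G v) where

    -- Otherwise the neighbours of a (resp. y) are all leaves, so by connectivity its closed
    -- neighbourhood would be the whole graph.
    centres-adjacent : a ≢ b → Edge G a b
    centres-adjacent a≢b = decidable-stable (Edge? a b) λ ¬e →
      [ (λ b≡a → a≢b (sym b≡a)) , ¬e ]′
        (leaf-neighbours⇒star connected (λ s e → leaves s (edge⇒≢ e ∘ sym) (λ { refl → ¬e e })) b)

    adjacent-to-centre : ∀ y → y ≢ a → y ≢ b → Edge G y a ⊎ Edge G y b
    adjacent-to-centre y y≢a y≢b = decidable-stable (Edge? y a ⊎-dec Edge? y b) λ ¬e →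
      [ (λ a≡y → y≢a (sym a≡y)) , (λ e → ¬e (inj₁ e)) ]′
        (leaf-neighbours⇒star connected
          (λ s e → leaves s (λ { refl → ¬e (inj₁ e) }) (λ { refl → ¬e (inj₂ e) })) a)

  -- Three consecutive vertices of a cycle each have two distinct neighbours on it.
  branching-in-pair⇒acyclic : ∀ {a b} →
    (∀ {v u u′} → Edge G v u → Edge G v u′ → u ≢ u′ → v ≡ a ⊎ v ≡ b) → ¬ HasCycle G
  branching-in-pair⇒acyclic branch (_ , _ , _ , _ , nil _ , () , _)
  branching-in-pair⇒acyclic branch (_ , _ , _ , _ , cons _ (nil _) , s≤s () , _)
  branching-in-pair⇒acyclic {a} {b} branch
    (x , y , _ , e , cons {y = v₁} e₁ (cons {y = v₂} e₂ w) , _ , (y∉ ∷ v₁∉ ∷ _)) =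
    pair-pigeonhole
      (branch (edge-sym e) e₁ (All.lookup v₁∉ (last∈verts w) ∘ sym))
      (branch (edge-sym e₁) e₂ y≢v₂)
      (third w v₁∉)
      y≢v₁ (All.lookup v₁∉ (head∈verts w)) y≢v₂
    where
    y≢v₁ : y ≢ v₁
    y≢v₁ = All.lookup y∉ (Any.here refl)
    y≢v₂ : y ≢ v₂
    y≢v₂ = All.lookup y∉ (Any.there (head∈verts w))
    third : ∀ {k} (w : Walk G v₂ x k) → All (v₁ ≢_) (verts G w) → v₂ ≡ a ⊎ v₂ ≡ b
    third (nil _)      _            = branch (edge-sym e₂) e (y≢v₁ ∘ sym)
    third (cons e₃ w′) (_ ∷ v₁∉w′) = branch (edge-sym e₂) e₃ (All.lookup v₁∉w′ (head∈verts w′))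

-- The tree joining each v ≢ a to parent v; the value parent a is irrelevant.
module ParentTree {n : ℕ} {a b : Fin n} (a≢b : a ≢ b) (parent : Fin n → Fin n)
  (parent-range : ∀ v → parent v ≡ a ⊎ parent v ≡ b) (parent[b]≡a : parent b ≡ a) where

  TreeEdge : Fin n → Fin n → Set
  TreeEdge u v = (u ≢ a × v ≡ parent u) ⊎ (v ≢ a × u ≡ parent v)

  TreeEdge? : ∀ u v → Dec (TreeEdge u v)
  TreeEdge? u v = (¬? (u ≟ a) ×-dec (v ≟ parent u)) ⊎-dec (¬? (v ≟ a) ×-dec (u ≟ parent v))

  parent≢ : ∀ v → v ≢ a → v ≢ parent v
  parent≢ v v≢a v≡p with parent-range v
  ... | inj₁ p≡a = v≢a (trans v≡p p≡a)
  ... | inj₂ p≡b = v≢a (trans v≡p (trans (cong parent (trans v≡p p≡b)) parent[b]≡a))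

  tree : Graph n
  tree = record
    { adj    = λ u v → does (TreeEdge? u v)
    ; sym    = λ u v → does-⇔ (mk⇔ TreeEdge-sym TreeEdge-sym) (TreeEdge? u v) (TreeEdge? v u)
    ; irrefl = λ v → dec-false (TreeEdge? v v) λ
        { (inj₁ (v≢a , v≡p)) → parent≢ v v≢a v≡p
        ; (inj₂ (v≢a , v≡p)) → parent≢ v v≢a v≡p }
    }
    where
    TreeEdge-sym : ∀ {u v} → TreeEdge u v → TreeEdge v u
    TreeEdge-sym = [ inj₂ , inj₁ ]′

  tree-edge : ∀ {u v} → TreeEdge u v → Edge tree u v
  tree-edge {u} {v} = dec-true (TreeEdge? u v)

  tree-edge⁻ : ∀ {u v} → Edge tree u v → TreeEdge u v
  tree-edge⁻ {u} {v} e = invert (subst (Reflects (TreeEdge u v)) e (proof (TreeEdge? u v)))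

  parent-edge : ∀ {v} → v ≢ a → Edge tree v (parent v)
  parent-edge v≢a = tree-edge (inj₁ (v≢a , refl))

  spanning : ∀ (G : Graph n) → (∀ v → v ≢ a → Edge G v (parent v)) → SpanningSubgraph tree G
  spanning G parent-edgeᴳ u v e with tree-edge⁻ {u} {v} e
  ... | inj₁ (u≢a , v≡p) = subst (Edge G u) (sym v≡p) (parent-edgeᴳ u u≢a)
  ... | inj₂ (v≢a , u≡p) = subst (λ w → Edge G w v) (sym u≡p) (edge-sym G (parent-edgeᴳ v v≢a))

  connected : Connected tree
  connected = reach-root⇒connected tree a reach-a
    where
    reach-a : ∀ v → ∃[ k ] Walk tree v a k
    reach-a v with v ≟ a | parent-range v
    ... | yes refl | _        = 0 , nil a
    ... | no v≢a   | inj₁ p≡a = 1 , cons (tree-edge (inj₁ (v≢a , sym p≡a))) (nil a)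
    ... | no v≢a   | inj₂ p≡b =
      2 , cons (tree-edge (inj₁ (v≢a , sym p≡b)))
            (cons (tree-edge (inj₁ (a≢b ∘ sym , sym parent[b]≡a))) (nil a))

  outer-edge : ∀ {v} → v ≢ a → v ≢ b → ∀ {u} → Edge tree v u → u ≡ parent v
  outer-edge {v} v≢a v≢b {u} e with tree-edge⁻ {v} {u} e
  ... | inj₁ (_ , u≡p) = u≡p
  ... | inj₂ (_ , v≡p) = ⊥-elim ([ v≢a ∘ trans v≡p , v≢b ∘ trans v≡p ]′ (parent-range u))

  branching-in-centres : ∀ {v u u′} → Edge tree v u → Edge tree v u′ → u ≢ u′ → v ≡ a ⊎ v ≡ b
  branching-in-centres {v} {u} {u′} e e′ u≢u′ =
    decidable-stable ((v ≟ a) ⊎-dec (v ≟ b)) λ ¬centre →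
      let outer = outer-edge (¬centre ∘ inj₁) (¬centre ∘ inj₂) in
      u≢u′ (trans (outer {u} e) (sym (outer {u′} e′)))

  doubleStar : (∃[ u ] (u ≢ a × u ≢ b × parent u ≡ a)) → (∃[ u ] (u ≢ a × parent u ≡ b)) →
    IsDoubleStar tree
  doubleStar (u , u≢a , u≢b , p[u]≡a) (u′ , u′≢a , p[u′]≡b) =
    (connected , branching-in-pair⇒acyclic tree branching-in-centres) ,
    a , b , a≢b ,
    two-neighbours⇒¬leaf tree (tree-edge (inj₂ (a≢b ∘ sym , sym parent[b]≡a)))
                              (tree-edge (inj₂ (u≢a , sym p[u]≡a))) (u≢b ∘ sym) ,
    two-neighbours⇒¬leaf tree (tree-edge (inj₁ (a≢b ∘ sym , sym parent[b]≡a)))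
                              (tree-edge (inj₂ (u′≢a , sym p[u′]≡b))) (u′≢a ∘ sym) ,
    λ v v≢a v≢b → unique-neighbour⇒leaf tree (parent-edge v≢a) (λ u → outer-edge v≢a v≢b {u})

module _ {n : ℕ} (G : Graph n) where

  parent-tree⇒spanningDoubleStar : ∀ {a b} → a ≢ b → (parent : Fin n → Fin n) →
    (∀ v → parent v ≡ a ⊎ parent v ≡ b) → parent b ≡ a → (∀ v → v ≢ a → Edge G v (parent v)) →
    (∃[ u ] (u ≢ a × u ≢ b × parent u ≡ a)) → (∃[ u ] (u ≢ a × parent u ≡ b)) →
    HasSpanningDoubleStar G
  parent-tree⇒spanningDoubleStar a≢b parent range parent[b]≡a edges leaf-at-a leaf-at-b =
    tree , spanning G edges , doubleStar leaf-at-a leaf-at-b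
    where open ParentTree a≢b parent range parent[b]≡a

  connected⇒neighbour : Connected G → ∀ {u v} → u ≢ v → ∃[ w ] Edge G u w
  connected⇒neighbour connected {u} {v} u≢v with connected u v
  ... | _ , nil _    = ⊥-elim (u≢v refl)
  ... | _ , cons e _ = _ , e

  Dominates : Fin n → Fin n → Set
  Dominates x z = ∀ y → y ≢ x → y ≢ z → Edge G x y ⊎ (Edge G x z × Edge G z y)

  module _ (no-universal : ¬ HasUniversalVertex G) where

    non-neighbour : ∀ v → ∃[ u ] (u ≢ v × ¬ Edge G v u)
    non-neighbour v = ∃-outside (Edge? G v) v λ universal → no-universal (v , universal)

    -- Centres x and z; every other vertex hangs from x when adjacent to it, from z otherwise.
    adjacent-dominating-pair⇒spanningDoubleStar : ∀ {x z} → Edge G x z → Dominates x z →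
      HasSpanningDoubleStar G
    adjacent-dominating-pair⇒spanningDoubleStar {x} {z} x~z dominates =
      parent-tree⇒spanningDoubleStar (edge⇒≢ G x~z) parent range
        (cong choose (dec-true (Edge? G x z) x~z)) edges leaf-at-x leaf-at-z
      where
      choose : Bool → Fin n
      choose c = if c then x else z
      parent : Fin n → Fin n
      parent v = choose (does (Edge? G x v))
      range : ∀ v → parent v ≡ x ⊎ parent v ≡ z
      range v with does (Edge? G x v)
      ... | true  = inj₁ refl
      ... | false = inj₂ refl
      edges : ∀ v → v ≢ x → Edge G v (parent v)
      edges v v≢x with Edge? G x v
      ... | yes x~v = edge-sym G x~v
      ... | no x≁v  = [ ⊥-elim ∘ x≁v , edge-sym G ∘ proj₂ ]′ (dominates v v≢x v≢z)
        where
        v≢z : v ≢ z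
        v≢z refl = x≁v x~z
      leaf-at-x : ∃[ u ] (u ≢ x × u ≢ z × parent u ≡ x)
      leaf-at-x with non-neighbour z
      ... | u , u≢z , z≁u = u , u≢x , u≢z , cong choose (dec-true (Edge? G x u) x~u)
        where
        u≢x : u ≢ x
        u≢x refl = z≁u (edge-sym G x~z)
        x~u : Edge G x u
        x~u = [ id , ⊥-elim ∘ z≁u ∘ proj₂ ]′ (dominates u u≢x u≢z)
      leaf-at-z : ∃[ u ] (u ≢ x × parent u ≡ z)
      leaf-at-z with non-neighbour x
      ... | u , u≢x , x≁u = u , u≢x , cong choose (dec-false (Edge? G x u) x≁u)

    -- Centres x and a neighbour w of z; z hangs from w, every other vertex from x.
    nonadjacent-dominating-pair⇒spanningDoubleStar : Connected G → ∀ {x z} → z ≢ x →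
      ¬ Edge G x z → Dominates x z → HasSpanningDoubleStar G
    nonadjacent-dominating-pair⇒spanningDoubleStar connected {x} {z} z≢x x≁z dominates
      with connected⇒neighbour connected z≢x
    ... | w , z~w =
      parent-tree⇒spanningDoubleStar (edge⇒≢ G x~w) parent range
        (cong choose (dec-false (w ≟ z) w≢z)) edges
        leaf-at-x (z , z≢x , cong choose (dec-true (z ≟ z) refl))
      where
      choose : Bool → Fin n
      choose c = if c then w else x
      parent : Fin n → Fin n
      parent v = choose (does (v ≟ z))
      w≢z : w ≢ z
      w≢z = edge⇒≢ G z~w ∘ sym
      x-adjacent : ∀ v → v ≢ x → v ≢ z → Edge G x v
      x-adjacent v v≢x v≢z = [ id , ⊥-elim ∘ x≁z ∘ proj₁ ]′ (dominates v v≢x v≢z)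
      w≢x : w ≢ x
      w≢x refl = x≁z (edge-sym G z~w)
      x~w : Edge G x w
      x~w = x-adjacent w w≢x w≢z
      range : ∀ v → parent v ≡ x ⊎ parent v ≡ w
      range v with does (v ≟ z)
      ... | true  = inj₂ refl
      ... | false = inj₁ refl
      edges : ∀ v → v ≢ x → Edge G v (parent v)
      edges v v≢x with v ≟ z
      ... | yes refl = z~w
      ... | no v≢z   = edge-sym G (x-adjacent v v≢x v≢z)
      leaf-at-x : ∃[ u ] (u ≢ x × u ≢ w × parent u ≡ x)
      leaf-at-x with non-neighbour w
      ... | u , u≢w , w≁u = u , u≢x , u≢w , cong choose (dec-false (u ≟ z) u≢z)
        where
        u≢x : u ≢ x
        u≢x refl = w≁u (edge-sym G x~w)
        u≢z : u ≢ z
        u≢z refl = w≁u (edge-sym G z~w)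

    dominating-pair⇒spanningDoubleStar : Connected G → ∀ {x z} → z ≢ x → Dominates x z →
      HasSpanningDoubleStar G
    dominating-pair⇒spanningDoubleStar connected {x} {z} z≢x dominates with Edge? G x z
    ... | yes x~z = adjacent-dominating-pair⇒spanningDoubleStar x~z dominates
    ... | no x≁z  = nonadjacent-dominating-pair⇒spanningDoubleStar connected z≢x x≁z dominates

  universal⇒visibilitySet : ∀ {x} → IsUniversal G x → IsVisibilitySet G x (∁ ⁅ x ⁆)
  universal⇒visibilitySet {x} universal =
    x∉∁⁅x⁆ , λ y y∈ → visible-neighbour G (universal y (x∈∁⁅y⁆⇒x≢y y∈)) x∉∁⁅x⁆
    where
    x∉∁⁅x⁆ : x ∉ ∁ ⁅ x ⁆
    x∉∁⁅x⁆ x∈ = x∈∁⁅y⁆⇒x≢y x∈ refl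

  visibilitySet-size≤n∸1 : ∀ {x S} → IsVisibilitySet G x S → ∣ S ∣ ≤ n ∸ 1
  visibilitySet-size≤n∸1 {x} {S} (x∉S , _) =
    subst (∣ S ∣ ≤_) (∣∁⁅x⁆∣≡n∸1 x) (p⊆q⇒∣p∣≤∣q∣ (x∉p⇒p⊆∁⁅x⁆ x∉S))

  covering-visibilitySet⇒universal : ∀ {x S} → IsVisibilitySet G x S →
    (∀ y → y ≢ x → y ∈ S) → IsUniversal G x
  covering-visibilitySet⇒universal (x∉S , visible) covers y y≢x =
    [ id , (λ (x~x , _) → ⊥-elim (edge⇒≢ G x~x refl)) ]′
      (visible⇒adjacent⊎through G x∉S (λ v v≢x _ → covers v v≢x) (covers y y≢x)
        (visible y (covers y y≢x)))

  visibilitySet-size≡n∸1⇒universal : ∀ {x S} → IsVisibilitySet G x S → ∣ S ∣ ≡ n ∸ 1 →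
    IsUniversal G x
  visibilitySet-size≡n∸1⇒universal {x} V@(x∉S , _) ∣S∣≡n∸1 = covering-visibilitySet⇒universal V
    λ y y≢x → p⊆q∧∣q∣≤∣p∣⇒q⊆p (x∉p⇒p⊆∁⁅x⁆ x∉S)
                (≤-reflexive (trans (∣∁⁅x⁆∣≡n∸1 x) (sym ∣S∣≡n∸1))) (x≢y⇒x∈∁⁅y⁆ y≢x)

  nonuniversal⇒visibilitySet-size≤n∸2 : ∀ {x S} → ¬ IsUniversal G x → IsVisibilitySet G x S →
    ∣ S ∣ ≤ n ∸ 2
  nonuniversal⇒visibilitySet-size≤n∸2 {S = S} ¬universal V =
    subst (∣ S ∣ ≤_) (pred[m∸n]≡m∸[1+n] n 1) (suc[m]≤n⇒m≤pred[n]
      (≤∧≢⇒< (visibilitySet-size≤n∸1 V) (¬universal ∘ visibilitySet-size≡n∸1⇒universal V)))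

  -- S misses some z ≢ x, and comparing sizes forces S to be exactly V ∖ {x, z}.
  visibilitySet-size≡n∸2⇒dominating-pair : ¬ HasUniversalVertex G → ∀ {x S} →
    IsVisibilitySet G x S → ∣ S ∣ ≡ n ∸ 2 → ∃[ z ] (z ≢ x × Dominates x z)
  visibilitySet-size≡n∸2⇒dominating-pair no-universal {x} {S} V@(x∉S , visible) ∣S∣≡n∸2
    with ∃-outside (_∈? S) x
           (λ covers → no-universal (x , covering-visibilitySet⇒universal V covers))
  ... | z , z≢x , z∉S = z , z≢x , λ y y≢x y≢z →
    visible⇒adjacent⊎through G x∉S (λ v v≢x v≢z → covered (∈rest v≢x v≢z)) (covered (∈rest y≢x y≢z))
      (visible y (covered (∈rest y≢x y≢z)))
    where
    ∈rest : ∀ {v} → v ≢ x → v ≢ z → v ∈ ∁ ⁅ x ⁆ - z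
    ∈rest v≢x v≢z = x∈p∧x≢y⇒x∈p-y (x≢y⇒x∈∁⁅y⁆ v≢x) v≢z
    S⊆rest : S ⊆ ∁ ⁅ x ⁆ - z
    S⊆rest {v} v∈S = ∈rest (λ { refl → x∉S v∈S }) (λ { refl → z∉S v∈S })
    covered : ∁ ⁅ x ⁆ - z ⊆ S
    covered = p⊆q∧∣q∣≤∣p∣⇒q⊆p S⊆rest (≤-reflexive (trans (∣∁⁅x⁆-y∣≡n∸2 z≢x) (sym ∣S∣≡n∸2)))

  spanningDoubleStar⇒visibilitySet : HasSpanningDoubleStar G →
    ∃[ a ] ∃[ S ] (IsVisibilitySet G a S × ∣ S ∣ ≡ n ∸ 2)
  spanningDoubleStar⇒visibilitySet (H , spanning , (connected , _) , a , b , a≢b , _ , _ , leaves) =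
    a , ∁ ⁅ a ⁆ - b , (a∉S , visible) , ∣∁⁅x⁆-y∣≡n∸2 (a≢b ∘ sym)
    where
    a∉S : a ∉ ∁ ⁅ a ⁆ - b
    a∉S a∈S = x∈∁⁅y⁆⇒x≢y (p─q⊆p _ _ a∈S) refl
    b∉S : b ∉ ∁ ⁅ a ⁆ - b
    b∉S b∈S = x∈p-y⇒x≢y b∈S refl
    a~b : Edge G a b
    a~b = spanning a b (centres-adjacent H connected leaves a≢b)
    visible : ∀ y → y ∈ ∁ ⁅ a ⁆ - b → Visible G a (∁ ⁅ a ⁆ - b) y
    visible y y∈S with Edge? G a y
    ... | yes a~y = visible-neighbour G a~y a∉S
    ... | no a≁y  =
      [ ⊥-elim ∘ a≁y ∘ spanning a y ∘ edge-sym H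
      , (λ y~b → visible-through G a~b (spanning b y (edge-sym H y~b)) a≁y (y≢a ∘ sym) a∉S b∉S) ]′
      (adjacent-to-centre H connected leaves y y≢a (x∈p-y⇒x≢y y∈S))
      where
      y≢a : y ≢ a
      y≢a = x∈∁⁅y⁆⇒x≢y (p─q⊆p _ _ y∈S)

  IsVV[n∸2]⇒¬universal : 2 ≤ n → IsVV G (n ∸ 2) → ¬ HasUniversalVertex G
  IsVV[n∸2]⇒¬universal (s≤s (s≤s _)) (_ , maximal) (x , universal) = 1+n≰n
    (subst (_≤ n ∸ 2) (∣∁⁅x⁆∣≡n∸1 x) (maximal x _ (universal⇒visibilitySet universal)))

  IsVV[n∸2]⇒spanningDoubleStar : 2 ≤ n → Connected G → IsVV G (n ∸ 2) → HasSpanningDoubleStar G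
  IsVV[n∸2]⇒spanningDoubleStar 2≤n connected vv@((_ , _ , V , ∣S∣≡n∸2) , _) =
    let no-universal = IsVV[n∸2]⇒¬universal 2≤n vv
        (_ , z≢x , dominates) = visibilitySet-size≡n∸2⇒dominating-pair no-universal V ∣S∣≡n∸2
    in  dominating-pair⇒spanningDoubleStar no-universal connected z≢x dominates

proposition3p1 : ∀ (n : ℕ) (G : Graph n) → 2 ≤ n → Connected G →
    (IsVV G (n ∸ 1) ⇔ HasUniversalVertex G) ×
    (IsVV G (n ∸ 2) ⇔ (¬ HasUniversalVertex G × HasSpanningDoubleStar G))
proposition3p1 n G 2≤n connected =
  mk⇔ (λ ((x , _ , V , ∣S∣≡n∸1) , _) → x , visibilitySet-size≡n∸1⇒universal G V ∣S∣≡n∸1)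
      (λ (x , universal) → (x , ∁ ⁅ x ⁆ , universal⇒visibilitySet G universal , ∣∁⁅x⁆∣≡n∸1 x) ,
                            λ _ _ → visibilitySet-size≤n∸1 G) ,
  mk⇔ (λ vv → IsVV[n∸2]⇒¬universal G 2≤n vv , IsVV[n∸2]⇒spanningDoubleStar G 2≤n connected vv)
      (λ (no-universal , doubleStar) → spanningDoubleStar⇒visibilitySet G doubleStar ,
         λ x _ → nonuniversal⇒visibilitySet-size≤n∸2 G (no-universal ∘ (x ,_)))
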